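{- Let $G$ be a graph with $\Delta(G)\le r$ and let $T\subseteq V(G)$ be a tight clique of size $t$. Let $S=S_T=\bigcap_{x\in T}N(x)$, let $R_T$ be the graph on vertex set $S$ whose edges are the pairs of vertices of $S$ not adjacent in $G$, and let \[ G_T = G+\binom{S}{2}-[S,V(G)\setminus(T\cup S)], \] i.e. the graph obtained from $G$ by adding all pairs inside $S$ as edges and deleting all edges between $S$ and $V(G)\setminus (T\cup S)$. Then \[ k(G_T)\ge k(G)+2^{r+1}-2^t\, i(R_T)-\phi(R_T). \]
   Context: Graphs are finite and simple. A clique is a set of pairwise adjacent vertices (the empty set included); $k(G)$ is the number of cliques of $G$ and $i(R)$ the number of independent sets of $R$ (including the empty set). For a nonempty clique $C$, $w(C)=|\bigcap_{x\in C}N(x)|$; with $\Delta(G)\le r$, a nonempty clique $C$ is tight if $w(C)=r+1-|C|$. For a graph $R$ and nonempty $I\subseteq V(R)$, $\delta_I=\min\{d_R(x):x\in I\}$, and the fixed loss of $R$ is \[ \phi(R)=\sum_{\substack{I \text{ independent in } R\\ I\neq\emptyset}}\bigl(2^{\delta_I}-1\bigr). \] -}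

module Defs where

open import Data.Bool using (Bool; true; false; not; _∧_; _∨_; if_then_else_)
open import Data.Nat using (ℕ; zero; suc; _+_; _*_; _∸_; _^_; _≤_; _⊓_)
open import Data.Fin using (Fin; _≟_)
open import Data.Fin.Subset using (Subset; inside; outside)
open import Data.Vec using (Vec; []; _∷_; lookup)
open import Data.List using (List; []; _∷_; [_]; map; _++_; length; filterᵇ; allFin)
open import Data.Bool.ListAction using (all; any)
open import Data.Nat.ListAction using (sum)
open import Relation.Nullary.Decidable using (⌊_⌋)
open import Relation.Binary.PropositionalEquality using (_≡_)

Adj : ℕ → Set
Adj n = Fin n → Fin n → Bool

record IsSimple {n : ℕ} (adj : Adj n) : Set where
  field
    sym    : ∀ x y → adj x y ≡ adj y x
    irrefl : ∀ x → adj x x ≡ false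

_∈ᵇ_ : ∀ {n} → Fin n → Subset n → Bool
x ∈ᵇ A = lookup A x

_≠ᵇ_ : ∀ {n} → Fin n → Fin n → Bool
x ≠ᵇ y = not ⌊ x ≟ y ⌋

allSubsets : (n : ℕ) → List (Subset n)
allSubsets zero    = [ [] ]
allSubsets (suc n) = map (outside ∷_) (allSubsets n) ++ map (inside ∷_) (allSubsets n)

countV : ∀ {n} → (Fin n → Bool) → ℕ
countV {n} p = length (filterᵇ p (allFin n))

size : ∀ {n} → Subset n → ℕ
size A = countV (_∈ᵇ A)

nonemptyᵇ : ∀ {n} → Subset n → Bool
nonemptyᵇ {n} A = any (_∈ᵇ A) (allFin n)

_⊆ᵇ_ : ∀ {n} → Subset n → Subset n → Bool
_⊆ᵇ_ {n} A B = all (λ x → not (x ∈ᵇ A) ∨ (x ∈ᵇ B)) (allFin n)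

isCliqueᵇ : ∀ {n} → Adj n → Subset n → Bool
isCliqueᵇ {n} adj C =
  all (λ x → all (λ y → not ((x ∈ᵇ C) ∧ (y ∈ᵇ C) ∧ (x ≠ᵇ y)) ∨ adj x y) (allFin n)) (allFin n)

-- k(G): number of cliques (including the empty one)
k : ∀ {n} → Adj n → ℕ
k {n} adj = length (filterᵇ (isCliqueᵇ adj) (allSubsets n))

deg : ∀ {n} → Adj n → Fin n → ℕ
deg adj x = countV (λ y → adj x y)

MaxDegLe : ∀ {n} → Adj n → ℕ → Set
MaxDegLe adj r = ∀ x → deg adj x ≤ r

commonNbhd : ∀ {n} → Adj n → Subset n → Subset n
commonNbhd {n} adj C = Data.Vec.tabulate (λ y → all (λ x → not (x ∈ᵇ C) ∨ adj x y) (allFin n))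

w : ∀ {n} → Adj n → Subset n → ℕ
w adj C = size (commonNbhd adj C)

-- T is a tight clique (w.r.t. the degree bound r): nonempty clique with w(T) = r + 1 - |T|.
-- (Stated without truncated subtraction as w(T) + |T| = r + 1.)
record TightClique {n : ℕ} (adj : Adj n) (r : ℕ) (T : Subset n) : Set where
  field
    clique   : isCliqueᵇ adj T ≡ true
    nonempty : nonemptyᵇ T ≡ true
    tight    : w adj T + size T ≡ suc r

-- Graphs R whose vertex set is a subset V of Fin n, adjacency adjR
-- (only its values on distinct pairs of V matter).

degR : ∀ {n} → Subset n → Adj n → Fin n → ℕ
degR V adjR x = countV (λ y → (y ∈ᵇ V) ∧ (x ≠ᵇ y) ∧ adjR x y)

isIndepᵇ : ∀ {n} → Subset n → Adj n → Subset n → Bool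
isIndepᵇ {n} V adjR I =
  (I ⊆ᵇ V) ∧
  all (λ x → all (λ y → not ((x ∈ᵇ I) ∧ (y ∈ᵇ I) ∧ (x ≠ᵇ y) ∧ adjR x y)) (allFin n)) (allFin n)

-- i(R): number of independent sets (including the empty one)
iR : ∀ {n} → Subset n → Adj n → ℕ
iR {n} V adjR = length (filterᵇ (isIndepᵇ V adjR) (allSubsets n))

-- minimum of a list (only used on nonempty lists)
minList : List ℕ → ℕ
minList []           = 0
minList (a ∷ [])     = a
minList (a ∷ b ∷ xs) = a ⊓ minList (b ∷ xs)

δ : ∀ {n} → Subset n → Adj n → Subset n → ℕ
δ {n} V adjR I = minList (map (degR V adjR) (filterᵇ (_∈ᵇ I) (allFin n)))

φ : ∀ {n} → Subset n → Adj n → ℕ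
φ {n} V adjR =
  sum (map (λ I → 2 ^ δ V adjR I ∸ 1)
           (filterᵇ (λ I → isIndepᵇ V adjR I ∧ nonemptyᵇ I) (allSubsets n)))

S_ : ∀ {n} → Adj n → Subset n → Subset n
S_ adj T = commonNbhd adj T

adjRT : ∀ {n} → Adj n → Adj n
adjRT adj x y = not (adj x y)

adjGT : ∀ {n} → Adj n → Subset n → Adj n
adjGT adj T x y =
  if (x ∈ᵇ S) ∧ (y ∈ᵇ S) ∧ (x ≠ᵇ y) then true
  else if ((x ∈ᵇ S) ∧ not ((y ∈ᵇ T) ∨ (y ∈ᵇ S))) ∨ ((y ∈ᵇ S) ∧ not ((x ∈ᵇ T) ∨ (x ∈ᵇ S))) then false
  else adj x y
  where S = S_ adj T

-- Split each clique C of G or of G_T as A ∪ B with A = C ∩ S and B ∩ S = ∅, and compare, for each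
-- A ⊆ S, the number of possible B. Since Δ(G) ≤ r and |T| + |S| = r + 1, a vertex of T has no
-- neighbour outside T ∪ S, so if A ∪ B is a clique of G then B ⊆ T or B lies in the set U A of common
-- neighbours of A outside T ∪ S, and the degree bound at a vertex of A gives |U A| ≤ δ_A. So for
-- nonempty A independent in R_T the graph G has at most 2^t + 2^δ_A − 1 such cliques, while G_T has
-- at least 2^t (every B ⊆ T); for A not independent G has none; and for A = ∅ nothing is lost, as G_T
-- agrees with G outside S. Summing over the 2^|S| sets A, with 2^|S| · 2^t = 2^(r+1), gives the result.

module Submission where

open import Data.Bool using (Bool; true; false; not; _∧_; _∨_; if_then_else_; T?)
open import Data.Bool.ListAction using (and; all; any)
open import Data.Bool.Properties using (T-≡; ∨-identityʳ; ∨-zeroʳ; ¬-not; not-involutive)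
open import Data.Fin using (Fin; zero; suc; _≟_)
open import Data.Fin.Subset using (Subset; _∪_; _∩_; ∁) renaming (⊥ to ∅)
open import Data.List using (List; []; _∷_; [_]; map; _++_; length; filterᵇ; allFin)
open import Data.List.Membership.Propositional using (_∈_; lose)
open import Data.List.Membership.Propositional.Properties using (∈-allFin; ∈-++⁻; ∈-map⁻; ∈-map⁺; ∈-filter⁺; ∈-filter⁻)
open import Data.List.Properties using (map-tabulate; map-∘)
import Data.List.Relation.Unary.All as All
open import Data.List.Relation.Unary.All.Properties using (all⁺; all⁻)
open import Data.List.Relation.Unary.Any using (here; there; satisfied)
open import Data.List.Relation.Unary.Any.Properties using (any⁺; any⁻)
open import Data.Nat using (ℕ; zero; suc; _+_; _*_; _∸_; _^_; _≤_; z≤n; s≤s)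
open import Data.Nat.ListAction using (sum)
open import Data.Nat.Properties hiding (_≟_)
open import Algebra.Properties.CommutativeSemigroup +-commutativeSemigroup using (interchange)
open import Data.Product using (∃; _×_; _,_; proj₁; proj₂)
open import Data.Sum using (_⊎_; inj₁; inj₂; [_,_]′)
open import Data.Vec using ([]; _∷_; lookup)
open import Data.Vec.Properties using (lookup-zipWith; lookup-map; lookup-replicate; lookup∘tabulate)
open import Function using (_∘_; id; case_of_; Equivalence)
open import Relation.Binary.PropositionalEquality hiding ([_])
open import Relation.Nullary using (¬_; contradiction)
open import Relation.Nullary.Decidable using (⌊_⌋; yes; no)

open import Defs

-- Indicators and finite sums

𝟙 : Bool → ℕ
𝟙 true  = 1
𝟙 false = 0

∑ : {A : Set} → List A → (A → ℕ) → ℕ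
∑ []       f = 0
∑ (x ∷ xs) f = f x + ∑ xs f

syntax ∑ xs (λ x → e) = ∑[ x ← xs ] e

module _ {A : Set} where

  ∑-++ : ∀ (xs ys : List A) f → ∑ (xs ++ ys) f ≡ ∑ xs f + ∑ ys f
  ∑-++ []       ys f = refl
  ∑-++ (x ∷ xs) ys f = trans (cong (f x +_) (∑-++ xs ys f)) (sym (+-assoc (f x) _ _))

  ∑-map : ∀ {B : Set} (g : B → A) xs f → ∑ (map g xs) f ≡ ∑ xs (f ∘ g)
  ∑-map g []       f = refl
  ∑-map g (x ∷ xs) f = cong (f (g x) +_) (∑-map g xs f)

  ∑-cong : ∀ (xs : List A) {f g} → (∀ x → f x ≡ g x) → ∑ xs f ≡ ∑ xs g
  ∑-cong []       f≡g = refl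
  ∑-cong (x ∷ xs) f≡g = cong₂ _+_ (f≡g x) (∑-cong xs f≡g)

  ∑-mono-≤ : ∀ (xs : List A) {f g} → (∀ {x} → x ∈ xs → f x ≤ g x) → ∑ xs f ≤ ∑ xs g
  ∑-mono-≤ []       f≤g = z≤n
  ∑-mono-≤ (x ∷ xs) f≤g = +-mono-≤ (f≤g (here refl)) (∑-mono-≤ xs (f≤g ∘ there))

  ∑-+ : ∀ (xs : List A) f g → ∑[ x ← xs ] (f x + g x) ≡ ∑ xs f + ∑ xs g
  ∑-+ []       f g = refl
  ∑-+ (x ∷ xs) f g =
    trans (cong (f x + g x +_) (∑-+ xs f g)) (interchange (f x) (g x) (∑ xs f) (∑ xs g))

  ∑-*ˡ : ∀ (xs : List A) c f → ∑[ x ← xs ] (c * f x) ≡ c * ∑ xs f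
  ∑-*ˡ []       c f = sym (*-zeroʳ c)
  ∑-*ˡ (x ∷ xs) c f = trans (cong (c * f x +_) (∑-*ˡ xs c f)) (sym (*-distribˡ-+ c (f x) _))

  ∑-zero : ∀ (xs : List A) → ∑[ x ← xs ] 0 ≡ 0
  ∑-zero []       = refl
  ∑-zero (x ∷ xs) = ∑-zero xs

  length-filterᵇ : ∀ p (xs : List A) → length (filterᵇ p xs) ≡ ∑[ x ← xs ] 𝟙 (p x)
  length-filterᵇ p []       = refl
  length-filterᵇ p (x ∷ xs) with p x
  ... | true  = cong suc (length-filterᵇ p xs)
  ... | false = length-filterᵇ p xs

  sum-map-filterᵇ : ∀ p g (xs : List A) →
    sum (map g (filterᵇ p xs)) ≡ ∑[ x ← xs ] (if p x then g x else 0)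
  sum-map-filterᵇ p g []       = refl
  sum-map-filterᵇ p g (x ∷ xs) with p x
  ... | true  = cong (g x +_) (sum-map-filterᵇ p g xs)
  ... | false = sum-map-filterᵇ p g xs

  all-true : ∀ {p : A → Bool} {xs x} → all p xs ≡ true → x ∈ xs → p x ≡ true
  all-true {p} {xs} h x∈xs =
    Equivalence.to T-≡ (All.lookup (all⁺ p xs (Equivalence.from T-≡ h)) x∈xs)

  all-intro : ∀ {p : A → Bool} xs → (∀ x → p x ≡ true) → all p xs ≡ true
  all-intro {p} xs h = Equivalence.to T-≡ (all⁻ p {xs} (All.tabulate λ {x} _ → Equivalence.from T-≡ (h x)))

  all-false : ∀ {p : A → Bool} xs → all p xs ≡ false → ∃ λ x → p x ≡ false
  all-false {p} (x ∷ xs) h with p x in px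
  ... | false = x , px
  ... | true  = all-false xs h

  any-true : ∀ {p : A → Bool} xs → any p xs ≡ true → ∃ λ x → p x ≡ true
  any-true {p} xs h with x , px ← satisfied (any⁻ p xs (Equivalence.from T-≡ h)) =
    x , Equivalence.to T-≡ px

  any-false : ∀ {p : A → Bool} {xs x} → any p xs ≡ false → x ∈ xs → p x ≡ false
  any-false {p} {xs} {x} h x∈xs with p x in px
  ... | false = refl
  ... | true  = contradiction
    (trans (sym (Equivalence.to T-≡ (any⁺ p (lose x∈xs (Equivalence.from T-≡ px))))) h) λ ()

𝟙-mono : ∀ {a b} → (a ≡ true → b ≡ true) → 𝟙 a ≤ 𝟙 b
𝟙-mono {false} a⇒b = z≤n
𝟙-mono {true}  a⇒b rewrite a⇒b refl = ≤-refl

𝟙-≤-∪-∩ : ∀ {c e p q} → (c ≡ true → p ≡ true ⊎ q ≡ true) → (e ≡ true → p ≡ true × q ≡ true) →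
  𝟙 c + 𝟙 e ≤ 𝟙 p + 𝟙 q
𝟙-≤-∪-∩ {false} {false} _ _ = z≤n
𝟙-≤-∪-∩ {true}  {false} {p} c⇒p∨q _ with c⇒p∨q refl
... | inj₁ refl = s≤s z≤n
... | inj₂ refl = m≤n+m 1 (𝟙 p)
𝟙-≤-∪-∩ {c}     {true}  _ e⇒p∧q with e⇒p∧q refl
... | refl , refl = +-monoˡ-≤ 1 (𝟙≤1 c)
  where
  𝟙≤1 : ∀ b → 𝟙 b ≤ 1
  𝟙≤1 false = z≤n
  𝟙≤1 true  = ≤-refl

¬true⇒false : ∀ {b} → b ≢ true → b ≡ false
¬true⇒false = ¬-not

∑-allFin-suc : ∀ {n} (f : Fin (suc n) → ℕ) → ∑ (allFin (suc n)) f ≡ f zero + ∑ (allFin n) (f ∘ suc)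
∑-allFin-suc {n} f =
  cong (f zero +_) (trans (cong (λ xs → ∑ xs f) (sym (map-tabulate id suc))) (∑-map suc (allFin n) f))

all-allFin-suc : ∀ {n} (p : Fin (suc n) → Bool) → all p (allFin (suc n)) ≡ p zero ∧ all (p ∘ suc) (allFin n)
all-allFin-suc {n} p =
  cong (λ xs → p zero ∧ and xs) (trans (cong (map p) (sym (map-tabulate id suc))) (sym (map-∘ (allFin n))))

countV-∑ : ∀ {n} (p : Fin n → Bool) → countV p ≡ ∑[ v ← allFin n ] 𝟙 (p v)
countV-∑ {n} p = length-filterᵇ p (allFin n)

⌊suc≟suc⌋ : ∀ {n} (x y : Fin n) → ⌊ suc x ≟ suc y ⌋ ≡ ⌊ x ≟ y ⌋
⌊suc≟suc⌋ x y with x ≟ y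
... | yes _ = refl
... | no  _ = refl

∑-≟ : ∀ {n} (y : Fin n) → ∑[ v ← allFin n ] 𝟙 ⌊ v ≟ y ⌋ ≡ 1
∑-≟ {suc n} zero    = trans (∑-allFin-suc {n} (λ v → 𝟙 ⌊ v ≟ zero ⌋)) (cong suc (∑-zero (allFin n)))
∑-≟ {suc n} (suc y) = trans (∑-allFin-suc {n} (λ v → 𝟙 ⌊ v ≟ suc y ⌋))
  (trans (∑-cong (allFin n) (λ v → cong 𝟙 (⌊suc≟suc⌋ v y))) (∑-≟ y))

≢⇒≠ᵇ : ∀ {n} {x y : Fin n} → x ≢ y → x ≠ᵇ y ≡ true
≢⇒≠ᵇ {x = x} {y} x≢y with x ≟ y
... | yes x≡y = contradiction x≡y x≢y
... | no  _   = refl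

-- Subsets of Fin n

-- Phrased with the Boolean membership _∈ᵇ_ of Defs, unlike Data.Fin.Subset._⊆_.
_⊆_ : ∀ {n} → Subset n → Subset n → Set
A ⊆ B = ∀ x → x ∈ᵇ A ≡ true → x ∈ᵇ B ≡ true

⊆-∷ : ∀ {n a b} {A B : Subset n} → (a ≡ true → b ≡ true) → A ⊆ B → (a ∷ A) ⊆ (b ∷ B)
⊆-∷ a⇒b A⊆B zero    = a⇒b
⊆-∷ a⇒b A⊆B (suc x) = A⊆B x

∈ᵇ-∪ : ∀ {n} (x : Fin n) A B → x ∈ᵇ (A ∪ B) ≡ (x ∈ᵇ A) ∨ (x ∈ᵇ B)
∈ᵇ-∪ x A B = lookup-zipWith _∨_ x A B

∈ᵇ-∁ : ∀ {n} (x : Fin n) A → x ∈ᵇ ∁ A ≡ not (x ∈ᵇ A)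
∈ᵇ-∁ x A = lookup-map x not A

∈ᵇ-∅ : ∀ {n} (x : Fin n) → x ∈ᵇ ∅ ≡ false
∈ᵇ-∅ x = lookup-replicate x false

∈-∪⁻ : ∀ {n} {x : Fin n} A B → x ∈ᵇ (A ∪ B) ≡ true → x ∈ᵇ A ≡ true ⊎ x ∈ᵇ B ≡ true
∈-∪⁻ {x = x} A B x∈A∪B with x ∈ᵇ A | x ∈ᵇ B | trans (sym (∈ᵇ-∪ x A B)) x∈A∪B
... | true  | _    | _ = inj₁ refl
... | false | true | _ = inj₂ refl

⊆-∪ˡ : ∀ {n} (A B : Subset n) → A ⊆ (A ∪ B)
⊆-∪ˡ A B x x∈A = trans (∈ᵇ-∪ x A B) (cong (_∨ _) x∈A)

⊆-∪ʳ : ∀ {n} (A B : Subset n) → B ⊆ (A ∪ B)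
⊆-∪ʳ A B x x∈B = trans (∈ᵇ-∪ x A B) (trans (cong (_ ∨_) x∈B) (∨-zeroʳ _))

∪-⊆ : ∀ {n} (A B X : Subset n) → A ⊆ X → B ⊆ X → (A ∪ B) ⊆ X
∪-⊆ A B X A⊆X B⊆X x x∈A∪B = [ A⊆X x , B⊆X x ]′ (∈-∪⁻ A B x∈A∪B)

∈∁⇒∉ : ∀ {n} {x : Fin n} A → x ∈ᵇ ∁ A ≡ true → x ∈ᵇ A ≡ false
∈∁⇒∉ {x = x} A x∈∁A = trans (sym (not-involutive _)) (cong not (trans (sym (∈ᵇ-∁ x A)) x∈∁A))

∈∉⇒≢ : ∀ {n} {x y : Fin n} A → x ∈ᵇ A ≡ true → y ∈ᵇ A ≡ false → x ≢ y
∈∉⇒≢ A x∈A y∉A refl = contradiction (trans (sym x∈A) y∉A) λ ()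

⊆ᵇ⇒⊆ : ∀ {n} (A B : Subset n) → A ⊆ᵇ B ≡ true → A ⊆ B
⊆ᵇ⇒⊆ A B h x x∈A with all-true {p = λ y → not (y ∈ᵇ A) ∨ (y ∈ᵇ B)} h (∈-allFin x)
... | x∈B rewrite x∈A = x∈B

⊆⇒⊆ᵇ : ∀ {n} (A B : Subset n) → A ⊆ B → A ⊆ᵇ B ≡ true
⊆⇒⊆ᵇ {n} A B A⊆B = all-intro (allFin n) pointwise
  where
  pointwise : ∀ x → not (x ∈ᵇ A) ∨ (x ∈ᵇ B) ≡ true
  pointwise x with x ∈ᵇ A in x∈A
  ... | false = refl
  ... | true  = A⊆B x x∈A

⊆ᵇ-false : ∀ {n} (A B : Subset n) → A ⊆ᵇ B ≡ false → ∃ λ x → x ∈ᵇ A ≡ true × x ∈ᵇ B ≡ false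
⊆ᵇ-false {n} A B h with x , h′ ← all-false (allFin n) h = x , implication-false _ _ h′
  where
  implication-false : ∀ a b → not a ∨ b ≡ false → a ≡ true × b ≡ false
  implication-false true false _ = refl , refl

⊆ᵇ-∷ : ∀ {n} a b (A B : Subset n) → ((a ∷ A) ⊆ᵇ (b ∷ B)) ≡ (not a ∨ b) ∧ (A ⊆ᵇ B)
⊆ᵇ-∷ a b A B = all-allFin-suc (λ y → not (y ∈ᵇ (a ∷ A)) ∨ (y ∈ᵇ (b ∷ B)))

∅-⊆ᵇ : ∀ {n} (B X : Subset n) → B ⊆ᵇ ∅ ≡ true → B ⊆ᵇ X ≡ true
∅-⊆ᵇ B X B⊆∅ = ⊆⇒⊆ᵇ B X λ x x∈B → contradiction (trans (sym (⊆ᵇ⇒⊆ B ∅ B⊆∅ x x∈B)) (∈ᵇ-∅ x)) λ ()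

size≡∑ : ∀ {n} (A : Subset n) → size A ≡ ∑[ v ← allFin n ] 𝟙 (v ∈ᵇ A)
size≡∑ A = countV-∑ (_∈ᵇ A)

size-∷ : ∀ {n} a (A : Subset n) → size (a ∷ A) ≡ 𝟙 a + size A
size-∷ a A = trans (countV-∑ (_∈ᵇ (a ∷ A)))
  (trans (∑-allFin-suc (λ y → 𝟙 (y ∈ᵇ (a ∷ A)))) (cong (𝟙 a +_) (sym (countV-∑ (_∈ᵇ A)))))

size-∅ : ∀ {n} → size {n} ∅ ≡ 0
size-∅ {n} = trans (size≡∑ {n} ∅) (trans (∑-cong (allFin n) (cong 𝟙 ∘ ∈ᵇ-∅)) (∑-zero (allFin n)))

subsetsOf : ∀ {n} → Subset n → List (Subset n)
subsetsOf []          = [ [] ]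
subsetsOf (false ∷ X) = map (false ∷_) (subsetsOf X)
subsetsOf (true ∷ X)  = map (false ∷_) (subsetsOf X) ++ map (true ∷_) (subsetsOf X)

∈-subsetsOf⇒⊆ : ∀ {n} {A X : Subset n} → A ∈ subsetsOf X → A ⊆ X
∈-subsetsOf⇒⊆ {X = []} _ ()
∈-subsetsOf⇒⊆ {X = false ∷ X} A∈ with ∈-map⁻ (false ∷_) A∈
... | A′ , A′∈ , refl = ⊆-∷ id (∈-subsetsOf⇒⊆ {X = X} A′∈)
∈-subsetsOf⇒⊆ {X = true ∷ X} A∈ with ∈-++⁻ (map (false ∷_) (subsetsOf X)) A∈
... | inj₁ A∈₀ with A′ , A′∈ , refl ← ∈-map⁻ (false ∷_) A∈₀ = ⊆-∷ (λ _ → refl) (∈-subsetsOf⇒⊆ {X = X} A′∈)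
... | inj₂ A∈₁ with A′ , A′∈ , refl ← ∈-map⁻ (true ∷_) A∈₁ = ⊆-∷ id (∈-subsetsOf⇒⊆ {X = X} A′∈)

∑-++-map-∷ : ∀ {n} (xs : List (Subset n)) f →
  ∑ (map (false ∷_) xs ++ map (true ∷_) xs) f ≡ ∑[ A ← xs ] f (false ∷ A) + ∑[ A ← xs ] f (true ∷ A)
∑-++-map-∷ xs f =
  trans (∑-++ (map (false ∷_) xs) _ f) (cong₂ _+_ (∑-map (false ∷_) xs f) (∑-map (true ∷_) xs f))

∑-subsetsOf-const : ∀ {n} (X : Subset n) c → ∑[ A ← subsetsOf X ] c ≡ 2 ^ size X * c
∑-subsetsOf-const []          c = refl
∑-subsetsOf-const (false ∷ X) c = begin
  ∑[ A ← map (false ∷_) (subsetsOf X) ] c  ≡⟨ ∑-map (false ∷_) (subsetsOf X) _ ⟩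
  ∑[ A ← subsetsOf X ] c                    ≡⟨ ∑-subsetsOf-const X c ⟩
  2 ^ size X * c                            ≡⟨ cong (λ s → 2 ^ s * c) (sym (size-∷ false X)) ⟩
  2 ^ size (false ∷ X) * c                  ∎
  where open ≡-Reasoning
∑-subsetsOf-const (true ∷ X)  c = begin
  ∑ (subsetsOf (true ∷ X)) (λ _ → c)       ≡⟨ ∑-++-map-∷ (subsetsOf X) _ ⟩
  ∑[ A ← subsetsOf X ] c + ∑[ A ← subsetsOf X ] c
                                            ≡⟨ cong₂ _+_ (∑-subsetsOf-const X c) (∑-subsetsOf-const X c) ⟩
  2 ^ size X * c + 2 ^ size X * c           ≡⟨ cong (λ m → 2 ^ size X * c + m * c) (sym (+-identityʳ (2 ^ size X))) ⟩
  2 ^ size X * c + (2 ^ size X + 0) * c     ≡⟨ sym (*-distribʳ-+ c (2 ^ size X) (2 ^ size X + 0)) ⟩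
  2 ^ suc (size X) * c                      ≡⟨ cong (λ s → 2 ^ s * c) (sym (size-∷ true X)) ⟩
  2 ^ size (true ∷ X) * c                   ∎
  where open ≡-Reasoning

∑-⊆ᵇ-∷ : ∀ {n} a b (X Y : Subset n) →
  ∑[ B ← subsetsOf X ] 𝟙 ((a ∷ B) ⊆ᵇ (b ∷ Y)) ≡ ∑[ B ← subsetsOf X ] 𝟙 ((not a ∨ b) ∧ (B ⊆ᵇ Y))
∑-⊆ᵇ-∷ a b X Y = ∑-cong (subsetsOf X) λ B → cong 𝟙 (⊆ᵇ-∷ a b B Y)

count-⊆ : ∀ {n} (X Y : Subset n) → Y ⊆ X → ∑[ B ← subsetsOf X ] 𝟙 (B ⊆ᵇ Y) ≡ 2 ^ size Y
count-⊆ []          []          _   = refl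
count-⊆ (false ∷ X) (true ∷ Y)  Y⊆X = contradiction (Y⊆X zero refl) λ ()
count-⊆ (false ∷ X) (false ∷ Y) Y⊆X = begin
  ∑[ B ← map (false ∷_) (subsetsOf X) ] 𝟙 (B ⊆ᵇ (false ∷ Y)) ≡⟨ ∑-map (false ∷_) (subsetsOf X) _ ⟩
  ∑[ B ← subsetsOf X ] 𝟙 ((false ∷ B) ⊆ᵇ (false ∷ Y))       ≡⟨ ∑-⊆ᵇ-∷ false false X Y ⟩
  ∑[ B ← subsetsOf X ] 𝟙 (B ⊆ᵇ Y)                          ≡⟨ count-⊆ X Y (Y⊆X ∘ suc) ⟩
  2 ^ size Y                                                ≡⟨ cong (2 ^_) (sym (size-∷ false Y)) ⟩
  2 ^ size (false ∷ Y)                                      ∎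
  where open ≡-Reasoning
count-⊆ (true ∷ X)  (y ∷ Y)     Y⊆X = begin
  ∑ (subsetsOf (true ∷ X)) (λ B → 𝟙 (B ⊆ᵇ (y ∷ Y)))
    ≡⟨ ∑-++-map-∷ (subsetsOf X) _ ⟩
  ∑[ B ← subsetsOf X ] 𝟙 ((false ∷ B) ⊆ᵇ (y ∷ Y)) + ∑[ B ← subsetsOf X ] 𝟙 ((true ∷ B) ⊆ᵇ (y ∷ Y))
    ≡⟨ cong₂ _+_ (∑-⊆ᵇ-∷ false y X Y) (∑-⊆ᵇ-∷ true y X Y) ⟩
  ∑[ B ← subsetsOf X ] 𝟙 (B ⊆ᵇ Y) + ∑[ B ← subsetsOf X ] 𝟙 (y ∧ (B ⊆ᵇ Y))
    ≡⟨ cases y ⟩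
  2 ^ size (y ∷ Y) ∎
  where
  open ≡-Reasoning
  IH = count-⊆ X Y (Y⊆X ∘ suc)
  cases : ∀ y → ∑[ B ← subsetsOf X ] 𝟙 (B ⊆ᵇ Y) + ∑[ B ← subsetsOf X ] 𝟙 (y ∧ (B ⊆ᵇ Y)) ≡ 2 ^ size (y ∷ Y)
  cases true  = trans (cong₂ _+_ IH (trans IH (sym (+-identityʳ _)))) (cong (2 ^_) (sym (size-∷ true Y)))
  cases false = trans (cong₂ _+_ IH (∑-zero (subsetsOf X))) (trans (+-identityʳ _) (cong (2 ^_) (sym (size-∷ false Y))))

count-⊆-∅ : ∀ {n} (X : Subset n) → ∑[ B ← subsetsOf X ] 𝟙 (B ⊆ᵇ ∅) ≡ 1
count-⊆-∅ {n} X = trans (count-⊆ X ∅ ∅⊆X) (cong (2 ^_) (size-∅ {n}))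
  where
  ∅⊆X : ∅ ⊆ X
  ∅⊆X x x∈∅ = contradiction (trans (sym x∈∅) (∈ᵇ-∅ x)) λ ()

∑-allSubsets-split : ∀ {n} (S : Subset n) (f : Subset n → ℕ) →
  ∑ (allSubsets n) f ≡ ∑[ A ← subsetsOf S ] ∑[ B ← subsetsOf (∁ S) ] f (A ∪ B)
∑-allSubsets-split [] f = sym (+-identityʳ _)
∑-allSubsets-split {suc n} (true ∷ S) f = begin
  ∑ (allSubsets (suc n)) f
    ≡⟨ ∑-++-map-∷ (allSubsets n) f ⟩
  ∑ (allSubsets n) (f ∘ (false ∷_)) + ∑ (allSubsets n) (f ∘ (true ∷_))
    ≡⟨ cong₂ _+_ (split-head false) (split-head true) ⟩
  ∑[ A ← subsetsOf S ] ∑[ B ← map (false ∷_) (subsetsOf (∁ S)) ] f ((false ∷ A) ∪ B)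
    + ∑[ A ← subsetsOf S ] ∑[ B ← map (false ∷_) (subsetsOf (∁ S)) ] f ((true ∷ A) ∪ B)
    ≡⟨ sym (∑-++-map-∷ (subsetsOf S) _) ⟩
  ∑ (subsetsOf (true ∷ S)) (λ A → ∑ (subsetsOf (∁ (true ∷ S))) (λ B → f (A ∪ B)))
    ∎
  where
  open ≡-Reasoning
  split-head : ∀ a → ∑ (allSubsets n) (f ∘ (a ∷_))
    ≡ ∑[ A ← subsetsOf S ] ∑[ B ← map (false ∷_) (subsetsOf (∁ S)) ] f ((a ∷ A) ∪ B)
  split-head a = trans (∑-allSubsets-split S (f ∘ (a ∷_)))
    (∑-cong (subsetsOf S) λ A → sym (trans (∑-map (false ∷_) (subsetsOf (∁ S)) _)
      (∑-cong (subsetsOf (∁ S)) λ B → cong (λ b → f (b ∷ (A ∪ B))) (∨-identityʳ a))))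
∑-allSubsets-split {suc n} (false ∷ S) f = begin
  ∑ (allSubsets (suc n)) f
    ≡⟨ ∑-++-map-∷ (allSubsets n) f ⟩
  ∑ (allSubsets n) (f ∘ (false ∷_)) + ∑ (allSubsets n) (f ∘ (true ∷_))
    ≡⟨ cong₂ _+_ (∑-allSubsets-split S _) (∑-allSubsets-split S _) ⟩
  ∑[ A ← subsetsOf S ] ∑[ B ← subsetsOf (∁ S) ] f (false ∷ (A ∪ B))
    + ∑[ A ← subsetsOf S ] ∑[ B ← subsetsOf (∁ S) ] f (true ∷ (A ∪ B))
    ≡⟨ sym (∑-+ (subsetsOf S) _ _) ⟩
  ∑[ A ← subsetsOf S ] (∑[ B ← subsetsOf (∁ S) ] f (false ∷ (A ∪ B)) + ∑[ B ← subsetsOf (∁ S) ] f (true ∷ (A ∪ B)))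
    ≡⟨ ∑-cong (subsetsOf S) (λ A → sym (∑-++-map-∷ (subsetsOf (∁ S)) _)) ⟩
  ∑[ A ← subsetsOf S ] ∑[ B ← subsetsOf (true ∷ ∁ S) ] f ((false ∷ A) ∪ B)
    ≡⟨ sym (∑-map (false ∷_) (subsetsOf S) _) ⟩
  ∑ (subsetsOf (false ∷ S)) (λ A → ∑ (subsetsOf (∁ (false ∷ S))) (λ B → f (A ∪ B)))
    ∎
  where open ≡-Reasoning

∑-allSubsets-restrict : ∀ {n} (S : Subset n) (f : Subset n → ℕ) → (∀ C → ¬ C ⊆ S → f C ≡ 0) →
  ∑ (allSubsets n) f ≡ ∑ (subsetsOf S) f
∑-allSubsets-restrict [] f _ = refl
∑-allSubsets-restrict {suc n} (true ∷ S) f vanish =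
  trans (∑-++-map-∷ (allSubsets n) f)
    (trans (cong₂ _+_ (restrict-head false) (restrict-head true)) (sym (∑-++-map-∷ (subsetsOf S) f)))
  where
  restrict-head : ∀ a → ∑ (allSubsets n) (f ∘ (a ∷_)) ≡ ∑ (subsetsOf S) (f ∘ (a ∷_))
  restrict-head a = ∑-allSubsets-restrict S _ λ C C⊈S → vanish (a ∷ C) λ aC⊆ → C⊈S (aC⊆ ∘ suc)
∑-allSubsets-restrict {suc n} (false ∷ S) f vanish = begin
  ∑ (allSubsets (suc n)) f
    ≡⟨ ∑-++-map-∷ (allSubsets n) f ⟩
  ∑ (allSubsets n) (f ∘ (false ∷_)) + ∑ (allSubsets n) (f ∘ (true ∷_))
    ≡⟨ cong₂ _+_ (∑-allSubsets-restrict S _ λ C C⊈S → vanish (false ∷ C) λ C⊆ → C⊈S (C⊆ ∘ suc))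
                 (trans (∑-cong (allSubsets n) λ C → vanish (true ∷ C) λ C⊆ → contradiction (C⊆ zero refl) λ ())
                        (∑-zero (allSubsets n))) ⟩
  ∑ (subsetsOf S) (f ∘ (false ∷_)) + 0
    ≡⟨ +-identityʳ _ ⟩
  ∑ (subsetsOf S) (f ∘ (false ∷_))
    ≡⟨ sym (∑-map (false ∷_) (subsetsOf S) f) ⟩
  ∑ (subsetsOf (false ∷ S)) f
    ∎
  where open ≡-Reasoning

-- Cliques, independent sets, common neighbourhoods

IsClique : ∀ {n} → Adj n → Subset n → Set
IsClique adj C = ∀ x y → x ∈ᵇ C ≡ true → y ∈ᵇ C ≡ true → x ≢ y → adj x y ≡ true

isCliqueᵇ⇒IsClique : ∀ {n} {adj : Adj n} C → isCliqueᵇ adj C ≡ true → IsClique adj C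
isCliqueᵇ⇒IsClique {n} {adj} C h x y x∈C y∈C x≢y
  with all-true {p = λ y → not ((x ∈ᵇ C) ∧ (y ∈ᵇ C) ∧ (x ≠ᵇ y)) ∨ adj x y}
         (all-true {xs = allFin n} h (∈-allFin x)) (∈-allFin y)
... | adj-xy rewrite x∈C | y∈C | ≢⇒≠ᵇ x≢y = adj-xy

IsClique⇒isCliqueᵇ : ∀ {n} {adj : Adj n} C → IsClique adj C → isCliqueᵇ adj C ≡ true
IsClique⇒isCliqueᵇ {n} {adj} C clique = all-intro (allFin n) λ x → all-intro (allFin n) (pair x)
  where
  pair : ∀ x y → not ((x ∈ᵇ C) ∧ (y ∈ᵇ C) ∧ (x ≠ᵇ y)) ∨ adj x y ≡ true
  pair x y with x ∈ᵇ C in x∈C | y ∈ᵇ C in y∈C | x ≟ y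
  ... | false | _     | _       = refl
  ... | true  | false | _       = refl
  ... | true  | true  | yes _   = refl
  ... | true  | true  | no x≢y  = clique x y x∈C y∈C x≢y

IsClique-⊆ : ∀ {n} {adj : Adj n} C D → D ⊆ C → IsClique adj C → IsClique adj D
IsClique-⊆ C D D⊆C clique x y x∈D y∈D = clique x y (D⊆C x x∈D) (D⊆C y y∈D)

IsIndependent : ∀ {n} → Adj n → Subset n → Set
IsIndependent adj I = ∀ x y → x ∈ᵇ I ≡ true → y ∈ᵇ I ≡ true → x ≢ y → adj x y ≡ false

isIndepᵇ⇒⊆ : ∀ {n} {adj : Adj n} V I → isIndepᵇ V adj I ≡ true → I ⊆ V
isIndepᵇ⇒⊆ V I h with I ⊆ᵇ V in I⊆V
... | true = ⊆ᵇ⇒⊆ I V I⊆V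

IsIndependent⇒isIndepᵇ : ∀ {n} {adj : Adj n} V I → I ⊆ V → IsIndependent adj I → isIndepᵇ V adj I ≡ true
IsIndependent⇒isIndepᵇ {n} {adj} V I I⊆V indep
  = cong₂ _∧_ (⊆⇒⊆ᵇ I V I⊆V) (all-intro (allFin n) λ x → all-intro (allFin n) (pair x))
  where
  pair : ∀ x y → not ((x ∈ᵇ I) ∧ (y ∈ᵇ I) ∧ (x ≠ᵇ y) ∧ adj x y) ≡ true
  pair x y with x ∈ᵇ I in x∈I | y ∈ᵇ I in y∈I | x ≟ y
  ... | false | _     | _      = refl
  ... | true  | false | _      = refl
  ... | true  | true  | yes _  = refl
  ... | true  | true  | no x≢y rewrite indep x y x∈I y∈I x≢y = refl

IsClique⇒IsIndependent-not : ∀ {n} {adj : Adj n} C → IsClique adj C → IsIndependent (λ x y → not (adj x y)) C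
IsClique⇒IsIndependent-not C clique x y x∈C y∈C x≢y = cong not (clique x y x∈C y∈C x≢y)

∈-commonNbhd⁻ : ∀ {n} {adj : Adj n} A {y a} → y ∈ᵇ commonNbhd adj A ≡ true → a ∈ᵇ A ≡ true → adj a y ≡ true
∈-commonNbhd⁻ {n} {adj} A {y} {a} h a∈A
  with all-true {p = λ x → not (x ∈ᵇ A) ∨ adj x y} (trans (sym (lookup∘tabulate _ y)) h) (∈-allFin a)
... | adj-ay rewrite a∈A = adj-ay

∈-commonNbhd⁺ : ∀ {n} {adj : Adj n} A {y} → (∀ a → a ∈ᵇ A ≡ true → adj a y ≡ true) → y ∈ᵇ commonNbhd adj A ≡ true
∈-commonNbhd⁺ {n} {adj} A {y} adjacent = trans (lookup∘tabulate _ y) (all-intro (allFin n) pointwise)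
  where
  pointwise : ∀ a → not (a ∈ᵇ A) ∨ adj a y ≡ true
  pointwise a with a ∈ᵇ A in a∈A
  ... | false = refl
  ... | true  = adjacent a a∈A

minList-glb : ∀ {m x} ys → x ∈ ys → (∀ {y} → y ∈ ys → m ≤ y) → m ≤ minList ys
minList-glb (y ∷ [])      _ lower = lower (here refl)
minList-glb (y ∷ y′ ∷ ys) _ lower = ⊓-glb (lower (here refl)) (minList-glb (y′ ∷ ys) (here refl) (lower ∘ there))

≤-δ : ∀ {n} (V : Subset n) adj I {m x} → x ∈ᵇ I ≡ true →
  (∀ y → y ∈ᵇ I ≡ true → m ≤ degR V adj y) → m ≤ δ V adj I
≤-δ {n} V adj I {m} {x} x∈I lower =
  minList-glb _ (∈-map⁺ (degR V adj) (∈-filter⁺ (T? ∘ (_∈ᵇ I)) (∈-allFin x) (Equivalence.from T-≡ x∈I)))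
    λ d∈ → case ∈-map⁻ (degR V adj) d∈ of λ where
      (y , y∈ , refl) → lower y (Equivalence.to T-≡ (proj₂ (∈-filter⁻ (T? ∘ (_∈ᵇ I)) {xs = allFin n} y∈)))

-- The graph G_T

module TightCliqueSwitch {n r : ℕ} {G : Adj n} (simple : IsSimple G) (Δ≤r : MaxDegLe G r)
                         {T : Subset n} (T-tight : TightClique G r T) where

  open IsSimple simple renaming (sym to G-sym; irrefl to G-irrefl)
  open TightClique T-tight renaming (clique to T-cliqueᵇ)

  S : Subset n
  S = S_ G T

  R : Adj n
  R = adjRT G

  Gᵀ : Adj n
  Gᵀ = adjGT G T

  T-clique : IsClique G T
  T-clique = isCliqueᵇ⇒IsClique T T-cliqueᵇ

  T-adj-S : ∀ {z y} → z ∈ᵇ T ≡ true → y ∈ᵇ S ≡ true → G z y ≡ true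
  T-adj-S z∈T y∈S = ∈-commonNbhd⁻ T y∈S z∈T

  T∉S : ∀ {z} → z ∈ᵇ T ≡ true → z ∈ᵇ S ≡ false
  T∉S {z} z∈T = ¬true⇒false λ z∈S → contradiction (trans (sym (T-adj-S z∈T z∈S)) (G-irrefl z)) λ ()

  S∉T : ∀ {y} → y ∈ᵇ S ≡ true → y ∈ᵇ T ≡ false
  S∉T y∈S = ¬true⇒false λ y∈T → contradiction (trans (sym y∈S) (T∉S y∈T)) λ ()

  T⊆∁S : T ⊆ ∁ S
  T⊆∁S y y∈T = trans (∈ᵇ-∁ y S) (cong not (T∉S y∈T))

  ∑-T+S : ∀ (f : Fin n → ℕ) → ∑[ v ← allFin n ] (𝟙 (v ∈ᵇ T) + 𝟙 (v ∈ᵇ S) + f v) ≡ suc r + ∑ (allFin n) f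
  ∑-T+S f = begin
    ∑[ v ← allFin n ] (𝟙 (v ∈ᵇ T) + 𝟙 (v ∈ᵇ S) + f v)
      ≡⟨ ∑-+ (allFin n) _ f ⟩
    ∑[ v ← allFin n ] (𝟙 (v ∈ᵇ T) + 𝟙 (v ∈ᵇ S)) + ∑ (allFin n) f
      ≡⟨ cong (_+ ∑ (allFin n) f) (∑-+ (allFin n) _ _) ⟩
    ∑[ v ← allFin n ] 𝟙 (v ∈ᵇ T) + ∑[ v ← allFin n ] 𝟙 (v ∈ᵇ S) + ∑ (allFin n) f
      ≡⟨ cong (_+ ∑ (allFin n) f) (sym (cong₂ _+_ (size≡∑ T) (size≡∑ S))) ⟩
    size T + size S + ∑ (allFin n) f
      ≡⟨ cong (_+ ∑ (allFin n) f) (trans (+-comm (size T) (size S)) tight) ⟩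
    suc r + ∑ (allFin n) f
      ∎
    where open ≡-Reasoning

  closedNbhd-bound : ∀ x (f e : Fin n → ℕ) → (∀ v → f v ≤ 𝟙 (G x v) + 𝟙 ⌊ v ≟ x ⌋ + e v) →
    ∑ (allFin n) f ≤ suc r + ∑ (allFin n) e
  closedNbhd-bound x f e f≤ = begin
    ∑ (allFin n) f
      ≤⟨ ∑-mono-≤ (allFin n) (λ {v} _ → f≤ v) ⟩
    ∑[ v ← allFin n ] (𝟙 (G x v) + 𝟙 ⌊ v ≟ x ⌋ + e v)
      ≡⟨ trans (∑-+ (allFin n) _ e) (cong (_+ ∑ (allFin n) e) (∑-+ (allFin n) _ _)) ⟩
    ∑[ v ← allFin n ] 𝟙 (G x v) + ∑[ v ← allFin n ] 𝟙 ⌊ v ≟ x ⌋ + ∑ (allFin n) e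
      ≡⟨ cong (λ m → m + ∑ (allFin n) e) (cong₂ _+_ (sym (countV-∑ (G x))) (∑-≟ x)) ⟩
    deg G x + 1 + ∑ (allFin n) e
      ≤⟨ +-monoˡ-≤ (∑ (allFin n) e) (+-monoˡ-≤ 1 (Δ≤r x)) ⟩
    r + 1 + ∑ (allFin n) e
      ≡⟨ cong (_+ ∑ (allFin n) e) (+-comm r 1) ⟩
    suc r + ∑ (allFin n) e
      ∎
    where open ≤-Reasoning

  -- z is adjacent to T − z and to all of S, which are already r vertices.
  T-nbr-in-T∪S : ∀ {z y} → z ∈ᵇ T ≡ true → G z y ≡ true → y ∈ᵇ T ≡ true ⊎ y ∈ᵇ S ≡ true
  T-nbr-in-T∪S {z} {y} z∈T zy with y ∈ᵇ T in y∈T | y ∈ᵇ S in y∈S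
  ... | true  | _     = inj₁ refl
  ... | false | true  = inj₂ refl
  ... | false | false = contradiction (+-cancelˡ-≤ (suc r) 1 0 too-many) λ ()
    where
    bound : ∀ v → 𝟙 (v ∈ᵇ T) + 𝟙 (v ∈ᵇ S) + 𝟙 ⌊ v ≟ y ⌋ ≤ 𝟙 (G z v) + 𝟙 ⌊ v ≟ z ⌋ + 0
    bound v with v ≟ z | v ≟ y
    ... | yes refl | yes refl = contradiction (trans (sym z∈T) y∈T) λ ()
    ... | yes refl | no _     rewrite z∈T | T∉S z∈T | G-irrefl z = ≤-refl
    ... | no _     | yes refl rewrite y∈T | y∈S | zy = ≤-refl
    ... | no v≢z   | no _ with v ∈ᵇ T in v∈T | v ∈ᵇ S in v∈S
    ...   | true  | true  = contradiction (trans (sym v∈S) (T∉S v∈T)) λ ()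
    ...   | true  | false rewrite T-clique z v z∈T v∈T (v≢z ∘ sym) = ≤-refl
    ...   | false | true  rewrite T-adj-S z∈T v∈S = ≤-refl
    ...   | false | false = z≤n
    too-many : suc r + 1 ≤ suc r + 0
    too-many = subst₂ _≤_ (trans (∑-T+S _) (cong (suc r +_) (∑-≟ y))) (cong (suc r +_) (∑-zero (allFin n)))
                 (closedNbhd-bound z _ (λ _ → 0) bound)

  U : Subset n → Subset n
  U A = ∁ (T ∪ S) ∩ commonNbhd G A

  ∈ᵇ-U : ∀ A y → y ∈ᵇ U A ≡ not ((y ∈ᵇ T) ∨ (y ∈ᵇ S)) ∧ (y ∈ᵇ commonNbhd G A)
  ∈ᵇ-U A y = trans (lookup-zipWith _∧_ y (∁ (T ∪ S)) _)
    (cong (_∧ _) (trans (∈ᵇ-∁ y (T ∪ S)) (cong not (∈ᵇ-∪ y T S))))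

  ∈U⁻ : ∀ A {y} → y ∈ᵇ U A ≡ true →
    y ∈ᵇ T ≡ false × y ∈ᵇ S ≡ false × (∀ a → a ∈ᵇ A ≡ true → G a y ≡ true)
  ∈U⁻ A {y} y∈U with y ∈ᵇ T | y ∈ᵇ S | y ∈ᵇ commonNbhd G A in y∈N | trans (sym (∈ᵇ-U A y)) y∈U
  ... | false | false | true | _ = refl , refl , λ a a∈A → ∈-commonNbhd⁻ A y∈N a∈A

  ∈U⁺ : ∀ A {y} → y ∈ᵇ T ≡ false → y ∈ᵇ S ≡ false → (∀ a → a ∈ᵇ A ≡ true → G a y ≡ true) →
    y ∈ᵇ U A ≡ true
  ∈U⁺ A {y} y∉T y∉S adjacent rewrite ∈ᵇ-U A y | y∉T | y∉S = ∈-commonNbhd⁺ A adjacent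

  U⊆∁S : ∀ A → U A ⊆ ∁ S
  U⊆∁S A y y∈U = trans (∈ᵇ-∁ y S) (cong not (proj₁ (proj₂ (∈U⁻ A y∈U))))

  -- x is adjacent to all of T, to U A, and to every vertex of S − x that is not an R-neighbour of x;
  -- as deg x ≤ r = |T| + |S| − 1, at most d_R(x) vertices remain for U A.
  size-U≤degR : ∀ A {x} → A ⊆ S → x ∈ᵇ A ≡ true → size (U A) ≤ degR S R x
  size-U≤degR A {x} A⊆S x∈A = +-cancelˡ-≤ (suc r) _ _
    (subst₂ _≤_ (trans (∑-T+S _) (cong (suc r +_) (sym (size≡∑ (U A))))) (cong (suc r +_) (sym (countV-∑ (λ v → (v ∈ᵇ S) ∧ (x ≠ᵇ v) ∧ R x v))))
      (closedNbhd-bound x _ _ bound))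
    where
    x∈S : x ∈ᵇ S ≡ true
    x∈S = A⊆S x x∈A
    bound : ∀ v → 𝟙 (v ∈ᵇ T) + 𝟙 (v ∈ᵇ S) + 𝟙 (v ∈ᵇ U A)
                ≤ 𝟙 (G x v) + 𝟙 ⌊ v ≟ x ⌋ + 𝟙 ((v ∈ᵇ S) ∧ (x ≠ᵇ v) ∧ R x v)
    bound v with v ≟ x | v ∈ᵇ U A in v∈U
    ... | yes refl | true  = contradiction (trans (sym x∈S) (proj₁ (proj₂ (∈U⁻ A v∈U)))) λ ()
    ... | yes refl | false rewrite S∉T x∈S | x∈S | G-irrefl x = s≤s z≤n
    ... | no _     | true  with v∉T , v∉S , adjacent ← ∈U⁻ A v∈U
                             rewrite v∉T | v∉S | adjacent x x∈A = s≤s z≤n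
    ... | no v≢x   | false with v ∈ᵇ T in v∈T | v ∈ᵇ S in v∈S
    ...   | true  | true  = contradiction (trans (sym v∈S) (T∉S v∈T)) λ ()
    ...   | true  | false rewrite G-sym x v | T-adj-S v∈T x∈S = s≤s z≤n
    ...   | false | false = z≤n
    ...   | false | true  rewrite ≢⇒≠ᵇ (v≢x ∘ sym) with G x v
    ...     | true  = s≤s z≤n
    ...     | false = s≤s z≤n

  size-U≤δ : ∀ A {x} → A ⊆ S → x ∈ᵇ A ≡ true → size (U A) ≤ δ S R A
  size-U≤δ A A⊆S x∈A = ≤-δ S R A x∈A λ y y∈A → size-U≤degR A A⊆S y∈A

  Gᵀ-within-S : ∀ {x y} → x ∈ᵇ S ≡ true → y ∈ᵇ S ≡ true → x ≢ y → Gᵀ x y ≡ true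
  Gᵀ-within-S {x} {y} x∈S y∈S x≢y rewrite x∈S | y∈S | ≢⇒≠ᵇ x≢y = refl

  Gᵀ-outside-S : ∀ {x y} → x ∈ᵇ S ≡ false → y ∈ᵇ S ≡ false → Gᵀ x y ≡ G x y
  Gᵀ-outside-S {x} {y} x∉S y∉S rewrite x∉S | y∉S = refl

  Gᵀ-S-T : ∀ {x y} → x ∈ᵇ S ≡ true → y ∈ᵇ T ≡ true → Gᵀ x y ≡ G x y
  Gᵀ-S-T {x} {y} x∈S y∈T rewrite x∈S | T∉S y∈T | y∈T = refl

  Gᵀ-T-S : ∀ {x y} → x ∈ᵇ T ≡ true → y ∈ᵇ S ≡ true → Gᵀ x y ≡ G x y
  Gᵀ-T-S {x} {y} x∈T y∈S rewrite T∉S x∈T | y∈S | x∈T = refl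

  S∪T-clique-in-Gᵀ : ∀ A B → A ⊆ S → B ⊆ T → IsClique Gᵀ (A ∪ B)
  S∪T-clique-in-Gᵀ A B A⊆S B⊆T x y x∈ y∈ x≢y with ∈-∪⁻ A B x∈ | ∈-∪⁻ A B y∈
  ... | inj₁ x∈A | inj₁ y∈A = Gᵀ-within-S (A⊆S x x∈A) (A⊆S y y∈A) x≢y
  ... | inj₁ x∈A | inj₂ y∈B =
    trans (Gᵀ-S-T (A⊆S x x∈A) (B⊆T y y∈B)) (trans (G-sym x y) (T-adj-S (B⊆T y y∈B) (A⊆S x x∈A)))
  ... | inj₂ x∈B | inj₁ y∈A = trans (Gᵀ-T-S (B⊆T x x∈B) (A⊆S y y∈A)) (T-adj-S (B⊆T x x∈B) (A⊆S y y∈A))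
  ... | inj₂ x∈B | inj₂ y∈B =
    trans (Gᵀ-outside-S (T∉S (B⊆T x x∈B)) (T∉S (B⊆T y y∈B))) (T-clique x y (B⊆T x x∈B) (B⊆T y y∈B) x≢y)

  clique-outside-S-in-Gᵀ : ∀ C → C ⊆ ∁ S → IsClique G C → IsClique Gᵀ C
  clique-outside-S-in-Gᵀ C C⊆∁S clique x y x∈C y∈C x≢y =
    trans (Gᵀ-outside-S (∈∁⇒∉ S (C⊆∁S x x∈C)) (∈∁⇒∉ S (C⊆∁S y y∈C))) (clique x y x∈C y∈C x≢y)

  clique-trace-independent : ∀ A B → A ⊆ S → IsClique G (A ∪ B) → isIndepᵇ S R A ≡ true
  clique-trace-independent A B A⊆S clique =
    IsIndependent⇒isIndepᵇ S A A⊆S (IsClique⇒IsIndependent-not A (IsClique-⊆ (A ∪ B) A (⊆-∪ˡ A B) clique))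

  clique-outer-part : ∀ A B → A ⊆ S → B ⊆ ∁ S → IsClique G (A ∪ B) → B ⊆ᵇ T ≡ false → B ⊆ U A
  clique-outer-part A B A⊆S B⊆∁S clique B⊈T y y∈B with y₀ , y₀∈B , y₀∉T ← ⊆ᵇ-false B T B⊈T =
    ∈U⁺ A y∉T y∉S λ a a∈A → clique a y (⊆-∪ˡ A B a a∈A) (⊆-∪ʳ A B y y∈B) (∈∉⇒≢ S (A⊆S a a∈A) y∉S)
    where
    y∉S : y ∈ᵇ S ≡ false
    y∉S = ∈∁⇒∉ S (B⊆∁S y y∈B)
    y∉T : y ∈ᵇ T ≡ false
    y∉T = ¬true⇒false λ y∈T →
      case T-nbr-in-T∪S y∈T (clique y y₀ (⊆-∪ʳ A B y y∈B) (⊆-∪ʳ A B y₀ y₀∈B) (∈∉⇒≢ T y∈T y₀∉T)) of λ where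
        (inj₁ y₀∈T) → contradiction (trans (sym y₀∈T) y₀∉T) λ ()
        (inj₂ y₀∈S) → contradiction (trans (sym y₀∈S) (∈∁⇒∉ S (B⊆∁S y₀ y₀∈B))) λ ()

  extensions : Adj n → Subset n → ℕ
  extensions H A = ∑[ B ← subsetsOf (∁ S) ] 𝟙 (isCliqueᵇ H (A ∪ B))

  k≡∑-extensions : ∀ H → k H ≡ ∑[ A ← subsetsOf S ] extensions H A
  k≡∑-extensions H = trans (length-filterᵇ (isCliqueᵇ H) (allSubsets n)) (∑-allSubsets-split S _)

  2^t≤extensions-Gᵀ : ∀ A → A ⊆ S → 2 ^ size T ≤ extensions Gᵀ A
  2^t≤extensions-Gᵀ A A⊆S = begin
    2 ^ size T                                   ≡⟨ sym (count-⊆ (∁ S) T T⊆∁S) ⟩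
    ∑[ B ← subsetsOf (∁ S) ] 𝟙 (B ⊆ᵇ T)           ≤⟨ ∑-mono-≤ (subsetsOf (∁ S)) (λ {B} _ → 𝟙-mono (clique B)) ⟩
    extensions Gᵀ A                              ∎
    where
    open ≤-Reasoning
    clique : ∀ B → B ⊆ᵇ T ≡ true → isCliqueᵇ Gᵀ (A ∪ B) ≡ true
    clique B B⊆T = IsClique⇒isCliqueᵇ (A ∪ B) (S∪T-clique-in-Gᵀ A B A⊆S (⊆ᵇ⇒⊆ B T B⊆T))

  extensions-G≤ : ∀ A {x} → A ⊆ S → x ∈ᵇ A ≡ true → extensions G A + 1 ≤ 2 ^ size T + 2 ^ δ S R A
  extensions-G≤ A A⊆S x∈A = begin
    extensions G A + 1
      ≡⟨ cong (extensions G A +_) (sym (count-⊆-∅ (∁ S))) ⟩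
    extensions G A + ∑[ B ← subsetsOf (∁ S) ] 𝟙 (B ⊆ᵇ ∅)
      ≡⟨ sym (∑-+ (subsetsOf (∁ S)) _ _) ⟩
    ∑[ B ← subsetsOf (∁ S) ] (𝟙 (isCliqueᵇ G (A ∪ B)) + 𝟙 (B ⊆ᵇ ∅))
      ≤⟨ ∑-mono-≤ (subsetsOf (∁ S)) (λ {B} B∈ → 𝟙-≤-∪-∩ (clique-in-T-or-U B (∈-subsetsOf⇒⊆ {X = ∁ S} B∈))
                                                        λ B⊆∅ → ∅-⊆ᵇ B T B⊆∅ , ∅-⊆ᵇ B (U A) B⊆∅) ⟩
    ∑[ B ← subsetsOf (∁ S) ] (𝟙 (B ⊆ᵇ T) + 𝟙 (B ⊆ᵇ U A))
      ≡⟨ trans (∑-+ (subsetsOf (∁ S)) _ _) (cong₂ _+_ (count-⊆ (∁ S) T T⊆∁S) (count-⊆ (∁ S) (U A) (U⊆∁S A))) ⟩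
    2 ^ size T + 2 ^ size (U A)
      ≤⟨ +-monoʳ-≤ (2 ^ size T) (^-monoʳ-≤ 2 (size-U≤δ A A⊆S x∈A)) ⟩
    2 ^ size T + 2 ^ δ S R A
      ∎
    where
    open ≤-Reasoning
    clique-in-T-or-U : ∀ B → B ⊆ ∁ S → isCliqueᵇ G (A ∪ B) ≡ true → B ⊆ᵇ T ≡ true ⊎ B ⊆ᵇ U A ≡ true
    clique-in-T-or-U B B⊆∁S clique with B ⊆ᵇ T in B⊆T
    ... | true  = inj₁ refl
    ... | false = inj₂ (⊆⇒⊆ᵇ B (U A) (clique-outer-part A B A⊆S B⊆∁S (isCliqueᵇ⇒IsClique (A ∪ B) clique) B⊆T))

  extensions-G≡0 : ∀ A → A ⊆ S → isIndepᵇ S R A ≡ false → extensions G A ≡ 0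
  extensions-G≡0 A A⊆S dependent = trans (∑-cong (subsetsOf (∁ S)) λ B → cong 𝟙 (no-clique B)) (∑-zero (subsetsOf (∁ S)))
    where
    no-clique : ∀ B → isCliqueᵇ G (A ∪ B) ≡ false
    no-clique B = ¬true⇒false λ clique →
      contradiction (trans (sym (clique-trace-independent A B A⊆S (isCliqueᵇ⇒IsClique (A ∪ B) clique))) dependent) λ ()

  extensions-G≤Gᵀ : ∀ A → (∀ x → x ∈ᵇ A ≡ false) → extensions G A ≤ extensions Gᵀ A
  extensions-G≤Gᵀ A A-empty = ∑-mono-≤ (subsetsOf (∁ S)) λ {B} B∈ → 𝟙-mono λ clique →
    IsClique⇒isCliqueᵇ (A ∪ B) (clique-outside-S-in-Gᵀ (A ∪ B)
      (∪-⊆ A B (∁ S) (λ x x∈A → contradiction (trans (sym x∈A) (A-empty x)) λ ()) (∈-subsetsOf⇒⊆ {X = ∁ S} B∈))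
      (isCliqueᵇ⇒IsClique (A ∪ B) clique))

  φ-term : Subset n → ℕ
  φ-term A = if isIndepᵇ S R A ∧ nonemptyᵇ A then 2 ^ δ S R A ∸ 1 else 0

  extensions-switch : ∀ A → A ⊆ S →
    extensions G A + 2 ^ size T ≤ extensions Gᵀ A + 2 ^ size T * 𝟙 (isIndepᵇ S R A) + φ-term A
  extensions-switch A A⊆S = by-cases (isIndepᵇ S R A) (nonemptyᵇ A) refl refl
    where
    t = size T
    A-empty : nonemptyᵇ A ≡ false → ∀ x → x ∈ᵇ A ≡ false
    A-empty empty x = any-false empty (∈-allFin x)
    by-cases : ∀ i e → isIndepᵇ S R A ≡ i → nonemptyᵇ A ≡ e →
      extensions G A + 2 ^ t ≤ extensions Gᵀ A + 2 ^ t * 𝟙 i + (if i ∧ e then 2 ^ δ S R A ∸ 1 else 0)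
    by-cases false false dependent empty = contradiction (trans (sym independent) dependent) λ ()
      where
      independent : isIndepᵇ S R A ≡ true
      independent = IsIndependent⇒isIndepᵇ S A A⊆S λ x _ x∈A → contradiction (trans (sym x∈A) (A-empty empty x)) λ ()
    by-cases true  false _ empty = begin
      extensions G A + 2 ^ t          ≤⟨ +-monoˡ-≤ (2 ^ t) (extensions-G≤Gᵀ A (A-empty empty)) ⟩
      extensions Gᵀ A + 2 ^ t         ≡⟨ cong (extensions Gᵀ A +_) (sym (*-identityʳ (2 ^ t))) ⟩
      extensions Gᵀ A + 2 ^ t * 1     ≡⟨ sym (+-identityʳ _) ⟩
      extensions Gᵀ A + 2 ^ t * 1 + 0 ∎
      where open ≤-Reasoning
    by-cases false true dependent _ = begin
      extensions G A + 2 ^ t          ≡⟨ cong (_+ 2 ^ t) (extensions-G≡0 A A⊆S dependent) ⟩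
      2 ^ t                           ≤⟨ 2^t≤extensions-Gᵀ A A⊆S ⟩
      extensions Gᵀ A                 ≡⟨ sym (trans (+-identityʳ _) (trans (cong (extensions Gᵀ A +_) (*-zeroʳ (2 ^ t))) (+-identityʳ _))) ⟩
      extensions Gᵀ A + 2 ^ t * 0 + 0 ∎
      where open ≤-Reasoning
    by-cases true  true  _ nonempty with x , x∈A ← any-true (allFin n) nonempty =
      combine (extensions-G≤ A A⊆S x∈A) (2^t≤extensions-Gᵀ A A⊆S) (m^n>0 2 (δ S R A))
      where
      combine : ∀ {a b c d} → a + 1 ≤ c + d → c ≤ b → 1 ≤ d → a + c ≤ b + c * 1 + (d ∸ 1)
      combine {a} {b} {c} {suc d} a+1≤c+d c≤b _ = begin
        a + c           ≤⟨ +-mono-≤ a≤c+d c≤b ⟩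
        c + d + b       ≡⟨ +-comm (c + d) b ⟩
        b + (c + d)     ≡⟨ sym (+-assoc b c d) ⟩
        b + c + d       ≡⟨ cong (λ m → b + m + d) (sym (*-identityʳ c)) ⟩
        b + c * 1 + d   ∎
        where
        open ≤-Reasoning
        a≤c+d : a ≤ c + d
        a≤c+d = ≤-pred (subst₂ _≤_ (+-comm a 1) (+-suc c d) a+1≤c+d)

  ⊈S⇒dependent : ∀ C → ¬ C ⊆ S → isIndepᵇ S R C ≡ false
  ⊈S⇒dependent C C⊈S = ¬true⇒false λ independent → C⊈S (isIndepᵇ⇒⊆ S C independent)

  iR≡∑ : iR S R ≡ ∑[ A ← subsetsOf S ] 𝟙 (isIndepᵇ S R A)
  iR≡∑ = trans (length-filterᵇ (isIndepᵇ S R) (allSubsets n))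
    (∑-allSubsets-restrict S _ λ C C⊈S → cong 𝟙 (⊈S⇒dependent C C⊈S))

  φ≡∑ : φ S R ≡ ∑[ A ← subsetsOf S ] φ-term A
  φ≡∑ = trans (sum-map-filterᵇ (λ I → isIndepᵇ S R I ∧ nonemptyᵇ I) (λ I → 2 ^ δ S R I ∸ 1) (allSubsets n))
    (∑-allSubsets-restrict S φ-term λ C C⊈S →
      cong (λ b → if b ∧ nonemptyᵇ C then 2 ^ δ S R C ∸ 1 else 0) (⊈S⇒dependent C C⊈S))

  2^[1+r]≡∑ : 2 ^ suc r ≡ ∑[ A ← subsetsOf S ] (2 ^ size T)
  2^[1+r]≡∑ = begin
    2 ^ suc r                         ≡⟨ cong (2 ^_) (sym tight) ⟩
    2 ^ (size S + size T)             ≡⟨ ^-distribˡ-+-* 2 (size S) (size T) ⟩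
    2 ^ size S * 2 ^ size T           ≡⟨ sym (∑-subsetsOf-const S (2 ^ size T)) ⟩
    ∑[ A ← subsetsOf S ] (2 ^ size T)   ∎
    where open ≡-Reasoning

lemma4p4 : (n r : ℕ) (G : Adj n) → IsSimple G → MaxDegLe G r →
    (T : Subset n) → TightClique G r T →
    k G + 2 ^ suc r ≤ k (adjGT G T) + 2 ^ size T * iR (S_ G T) (adjRT G) + φ (S_ G T) (adjRT G)
lemma4p4 n r G simple Δ≤r T T-tight = begin
  k G + 2 ^ suc r
    ≡⟨ cong₂ _+_ (k≡∑-extensions G) 2^[1+r]≡∑ ⟩
  ∑[ A ← subsetsOf S ] extensions G A + ∑[ A ← subsetsOf S ] (2 ^ size T)
    ≡⟨ sym (∑-+ (subsetsOf S) _ _) ⟩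
  ∑[ A ← subsetsOf S ] (extensions G A + 2 ^ size T)
    ≤⟨ ∑-mono-≤ (subsetsOf S) (λ {A} A∈ → extensions-switch A (∈-subsetsOf⇒⊆ {X = S} A∈)) ⟩
  ∑[ A ← subsetsOf S ] (extensions Gᵀ A + 2 ^ size T * 𝟙 (isIndepᵇ S R A) + φ-term A)
    ≡⟨ trans (∑-+ (subsetsOf S) _ φ-term) (cong₂ _+_ (∑-+ (subsetsOf S) _ _) (sym φ≡∑)) ⟩
  ∑[ A ← subsetsOf S ] extensions Gᵀ A + ∑[ A ← subsetsOf S ] (2 ^ size T * 𝟙 (isIndepᵇ S R A)) + φ S R
    ≡⟨ cong₂ (λ a b → a + b + φ S R) (sym (k≡∑-extensions Gᵀ))
             (trans (∑-*ˡ (subsetsOf S) (2 ^ size T) _) (cong (2 ^ size T *_) (sym iR≡∑))) ⟩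
  k Gᵀ + 2 ^ size T * iR S R + φ S R
    ∎
  where
  open TightCliqueSwitch simple Δ≤r T-tight
  open ≤-Reasoning
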